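{- $[\tau(\mathbf{CInd})\mathbf{Txt}\mathbf{Sd}\mathbf{Ex}_C]_{\mathbf{REC}} \setminus [\mathbf{Txt}\mathbf{It}\mathbf{Ex}_W]_{\mathbf{REC}} \neq \emptyset$.
   Context: Fix an acceptable numbering $(\varphi_e)_{e\in\mathbb{N}}$ of all partial computable functions. $W_e=\mathrm{dom}(\varphi_e)$. A number $e$ is a $C$-index if $\varphi_e$ is total with values in $\{0,1\}$; then $C_e=\{x:\varphi_e(x)=1\}$. $\mathbf{REC}$ is the collection of recursive subsets of $\mathbb{N}$; $\mathcal{P}$ denotes the partial computable functions. Fix a pause symbol $\#$. A text is a total function $T:\mathbb{N}\to\mathbb{N}\cup\{\#\}$, $\mathrm{content}(T)=\mathrm{range}(T)\setminus\{\#\}$, $T$ is a text for $L$ if $\mathrm{content}(T)=L$, $T[n]=(T(0),\dots,T(n-1))$. A learner is some $h\in\mathcal{P}$. Hypothesis sequences: set-driven $\mathbf{Sd}(h,T)(i)=h(\mathrm{content}(T[i]))$; iterative $\mathbf{It}(h,T)(0)=h(\varepsilon)$ and $\mathbf{It}(h,T)(i)=h(\mathbf{It}(h,T)(i-1),T(i-1))$ for $i>0$. Restrictions on hypothesis sequence $p$ and text $T$: $\mathbf{Ex}_C$: there is $n_0$ with $p(n)=p(n_0)$ for all $n\ge n_0$ and $p(n_0)$ a $C$-index with $C_{p(n_0)}=\mathrm{content}(T)$; $\mathbf{Ex}_W$: same but with $W_{p(n_0)}=\mathrm{content}(T)$; $\mathbf{CInd}$: for all $i$, $p(i)$ is a $C$-index.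 A learner $h$ $\tau(\alpha)\mathbf{Txt}\beta\delta$-learns $L$ iff $\alpha(\beta(h,T),T)$ holds for every text $T$ whatsoever and $\delta(\beta(h,T),T)$ holds for every text $T$ for $L$ (omitting $\tau(\alpha)$ means no global requirement). $[\tau(\alpha)\mathbf{Txt}\beta\delta]_{\mathbf{REC}}$ is the set of all classes $\mathcal{L}\subseteq\mathbf{REC}$ for which some $h\in\mathcal{P}$ learns every $L\in\mathcal{L}$ in this sense. -}

module Defs where

open import Data.Nat using (ℕ; zero; suc; _+_; _*_; _^_; _≤_; _≟_)
open import Data.Nat.DivMod using (_/_; _%_)
open import Data.Nat.ListAction using (sum)
open import Data.List using (List; []; _∷_; map; upTo; catMaybes; deduplicate)
open import Data.Maybe using (Maybe; just; nothing; _>>=_)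
open import Data.Product using (Σ; _×_; _,_; ∃; ∃-syntax)
open import Data.Sum using (_⊎_)
open import Data.Unit using (⊤)
open import Relation.Binary.PropositionalEquality using (_≡_)
open import Relation.Nullary using (¬_)

-- A concrete acceptable numbering: Gödel numbering of μ-recursive
-- function codes, evaluated with a step/fuel bound.

pair : ℕ → ℕ → ℕ
pair a b = ((a + b) * suc (a + b)) / 2 + a

private
  next : ℕ × ℕ → ℕ × ℕ
  next (x , zero)  = (0 , suc x)
  next (x , suc y) = (suc x , y)

unpair : ℕ → ℕ × ℕ
unpair zero    = (0 , 0)
unpair (suc n) = next (unpair n)

-- μ-recursive codes acting on argument lists (missing arguments read as 0).
data Code : Set where
  zeroC : Code
  succC : Code
  projC : ℕ → Code
  compC : Code → List Code → Code
  precC : Code → Code → Code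
  muC   : Code → Code

arg : ℕ → List ℕ → ℕ
arg _       []       = 0
arg zero    (x ∷ _)  = x
arg (suc i) (_ ∷ xs) = arg i xs

mutual
  -- eval k c xs : result of running c on xs with fuel k (nothing = no
  -- result within the fuel bound).
  eval : ℕ → Code → List ℕ → Maybe ℕ
  eval zero    _           _  = nothing
  eval (suc k) zeroC       _  = just 0
  eval (suc k) succC       xs = just (suc (arg 0 xs))
  eval (suc k) (projC i)   xs = just (arg i xs)
  eval (suc k) (compC f gs) xs = evalList k gs xs >>= λ ys → eval k f ys
  eval (suc k) (precC f g) []       = eval k f []
  eval (suc k) (precC f g) (n ∷ ys) = precLoop k f g n ys
  eval (suc k) (muC f)     xs = muLoop k f xs k 0

  evalList : ℕ → List Code → List ℕ → Maybe (List ℕ)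
  evalList k []       xs = just []
  evalList k (g ∷ gs) xs = eval k g xs >>= λ y → evalList k gs xs >>= λ ys → just (y ∷ ys)

  precLoop : ℕ → Code → Code → ℕ → List ℕ → Maybe ℕ
  precLoop k f g zero    ys = eval k f ys
  precLoop k f g (suc m) ys = precLoop k f g m ys >>= λ r → eval k g (m ∷ r ∷ ys)

  muLoop : ℕ → Code → List ℕ → ℕ → ℕ → Maybe ℕ
  muLoop k f xs zero    i = nothing
  muLoop k f xs (suc j) i with eval k f (i ∷ xs)
  ... | nothing       = nothing
  ... | just zero     = just i
  ... | just (suc _)  = muLoop k f xs j (suc i)

-- Decoding natural numbers to codes (fuel argument first; fuel e suffices
-- for the number e).
mutual
  decodeF : ℕ → ℕ → Code
  decodeF zero    e = zeroC
  decodeF (suc f) e = byTag (e % 6) (e / 6)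
    where
    byTag : ℕ → ℕ → Code
    byTag 0 r = zeroC
    byTag 1 r = succC
    byTag 2 r = projC r
    byTag 3 r with unpair r
    ... | (a , b) = compC (decodeF f a) (decodeListF f b)
    byTag 4 r with unpair r
    ... | (a , b) = precC (decodeF f a) (decodeF f b)
    byTag 5 r = muC (decodeF f r)
    byTag _ r = zeroC

  decodeListF : ℕ → ℕ → List Code
  decodeListF zero    _       = []
  decodeListF (suc f) zero    = []
  decodeListF (suc f) (suc m) with unpair m
  ... | (a , b) = decodeF f a ∷ decodeListF f b

decode : ℕ → Code
decode e = decodeF e e

_·_⇓_ : ℕ → ℕ → ℕ → Set
e · x ⇓ y = ∃[ k ] eval k (decode e) (x ∷ []) ≡ just y

W : ℕ → ℕ → Set
W e x = ∃[ y ] e · x ⇓ y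

CIndex : ℕ → Set
CIndex e = ∀ x → (e · x ⇓ 0) ⊎ (e · x ⇓ 1)

C : ℕ → ℕ → Set
C e x = e · x ⇓ 1

SetN : Set₁
SetN = ℕ → Set

_≐_ : SetN → SetN → Set
A ≐ B = ∀ x → (A x → B x) × (B x → A x)

REC : SetN → Set
REC L = ∃[ e ] CIndex e × (C e ≐ L)

-- nothing represents the pause symbol #
Text : Set
Text = ℕ → Maybe ℕ

content : Text → SetN
content T x = ∃[ n ] T n ≡ just x

TextFor : Text → SetN → Set
TextFor T L = content T ≐ L

codeD : Maybe ℕ → ℕ
codeD nothing  = 0
codeD (just n) = suc n

contentCode : Text → ℕ → ℕ
contentCode T i = sum (map (2 ^_) (deduplicate _≟_ (catMaybes (map T (upTo i)))))

-- (partial) hypothesis sequences, as single-valued relations  p i e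
Seq : Set₁
Seq = ℕ → ℕ → Set

Sd : ℕ → Text → Seq
Sd h T i e = h · contentCode T i ⇓ e

-- iterative: It(h,T)(0) = h(ε), It(h,T)(i+1) = h(It(h,T)(i), T(i));
-- ε is coded as 0 and the pair (p , d) as 1 + pair p (codeD d).
It : ℕ → Text → Seq
It h T zero    e = h · 0 ⇓ e
It h T (suc i) e = ∃[ q ] It h T i q × (h · suc (pair q (codeD (T i))) ⇓ e)

Total : Seq → Set
Total p = ∀ i → ∃[ e ] p i e

Restriction : Set₁
Restriction = Seq → Text → Set

NoRestr : Restriction
NoRestr _ _ = ⊤

CInd : Restriction
CInd p T = ∀ i → ∃[ e ] p i e × CIndex e

ExC : Restriction
ExC p T = Total p × ∃[ n₀ ] ∃[ e ] (∀ n → n₀ ≤ n → p n e) × CIndex e × (C e ≐ content T)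

ExW : Restriction
ExW p T = Total p × ∃[ n₀ ] ∃[ e ] (∀ n → n₀ ≤ n → p n e) × (W e ≐ content T)

Learns : Restriction → (ℕ → Text → Seq) → Restriction → ℕ → SetN → Set
Learns α β δ h L = (∀ T → α (β h T) T) × (∀ T → TextFor T L → δ (β h T) T)

InClassREC : Restriction → (ℕ → Text → Seq) → Restriction → (SetN → Set) → Set₁
InClassREC α β δ 𝓛 = (∀ L → 𝓛 L → REC L) × (∃[ h ] ∀ L → 𝓛 L → Learns α β δ h L)

-- The class consists of ℕ ∖ {0} and all finite sets containing 0. Its set-driven
-- learner reads the canonical index c of the data seen so far: while 0 has not
-- appeared (c is even) it conjectures a decider for ℕ ∖ {0}, afterwards a decider
-- for the finite set D_c, which is correct once the whole finite language has
-- appeared. Every conjecture, on every text, is a decider.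
-- An iterative learner h of the class converges on the text 1, 2, 3, … by some
-- stage m. The texts 1, …, m, 0, 0, … and 1, …, m+1, 0, 0, … bring h into the same
-- state at stages m and m+1 and feed it the same data afterwards, so h has the
-- same limit on both, although only the second contains m+1.
-- The numbering is concrete, so the deciders and the learner are written out as
-- μ-recursive codes together with their Gödel numbers.

module Submission where

open import Defs
open import Data.Empty using (⊥)
open import Data.List using (List; []; _∷_; drop; map; upTo; catMaybes)
open import Data.List.Membership.Propositional using (_∈_)
open import Data.List.Membership.Propositional.Properties
  using (∈-map⁺; ∈-map⁻; ∈-upTo⁺; ∈-upTo⁻; deduplicate-∈⇔)
import Data.List.Relation.Unary.All as All
open import Data.List.Relation.Unary.AllPairs using ([]; _∷_)
open import Data.List.Relation.Unary.Any using (here; there)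
open import Data.List.Relation.Unary.Unique.DecPropositional.Properties using (deduplicate-!)
open import Data.List.Relation.Unary.Unique.Propositional using (Unique)
open import Data.Maybe using (Maybe; just; nothing; _>>=_)
open import Data.Maybe.Properties using (just-injective)
open import Data.Nat hiding (parity)
open import Data.Nat.DivMod
  using (_%_; _/_; [m+kn]%n≡m%n; m<n⇒m%n≡m; +-distrib-/-∣ʳ; m<n⇒m/n≡0; m*n/n≡m)
open import Data.Nat.Divisibility using (divides-refl)
open import Data.Nat.ListAction using (sum)
open import Data.Nat.Properties
open import Data.Product using (Σ-syntax; ∃-syntax; _×_; _,_; proj₁; proj₂; swap)
open import Data.Sum using (_⊎_; inj₁; inj₂)
import Data.Sum as Sum
open import Function using (_∘_; id; case_of_; _⇔_; mk⇔; Equivalence)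
open import Relation.Binary.PropositionalEquality
open import Relation.Nullary using (¬_; yes; no; contradiction)
open import Relation.Nullary.Decidable using (True; toWitness)
open import Relation.Unary using (Decidable)

-- Evaluation is monotone in the fuel

>>=-just⁻ : ∀ {A B : Set} (m : Maybe A) {f : A → Maybe B} {b} →
            (m >>= f) ≡ just b → ∃[ a ] m ≡ just a × f a ≡ just b
>>=-just⁻ (just a) eq = a , refl , eq

>>=-just⁺ : ∀ {A B : Set} {m : Maybe A} {f : A → Maybe B} {a b} →
            m ≡ just a → f a ≡ just b → (m >>= f) ≡ just b
>>=-just⁺ refl eq = eq

record FuelMonotone {A : Set} (run : ℕ → Maybe A) : Set where
  field fuel-suc : ∀ {k a} → run k ≡ just a → run (suc k) ≡ just a
open FuelMonotone

Converges : {A : Set} → (ℕ → Maybe A) → A → Set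
Converges run a = ∃[ k ] run k ≡ just a

module _ {A : Set} {run : ℕ → Maybe A} (mono : FuelMonotone run) where

  fuel-mono-≤ : ∀ {k k′ a} → k ≤ k′ → run k ≡ just a → run k′ ≡ just a
  fuel-mono-≤ k≤k′ = go (≤⇒≤′ k≤k′)
    where
    go : ∀ {k k′ a} → k ≤′ k′ → run k ≡ just a → run k′ ≡ just a
    go ≤′-refl         eq = eq
    go (≤′-step k≤′k′) eq = fuel-suc mono (go k≤′k′ eq)

  converges-deterministic : ∀ {a b} → Converges run a → Converges run b → a ≡ b
  converges-deterministic (k , eqa) (k′ , eqb) with
    trans (sym (fuel-mono-≤ (m≤m⊔n k k′) eqa)) (fuel-mono-≤ (m≤n⊔m k k′) eqb)
  ... | refl = refl

converge-together : ∀ {A B : Set} {run : ℕ → Maybe A} {run′ : ℕ → Maybe B} {a b} →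
                    FuelMonotone run → FuelMonotone run′ →
                    Converges run a → Converges run′ b →
                    ∃[ k ] run k ≡ just a × run′ k ≡ just b
converge-together mono mono′ (k , eq) (k′ , eq′) =
  k ⊔ k′ , fuel-mono-≤ mono (m≤m⊔n k k′) eq , fuel-mono-≤ mono′ (m≤n⊔m k k′) eq′

mutual
  eval-suc : ∀ c xs {k a} → eval k c xs ≡ just a → eval (suc k) c xs ≡ just a
  eval-suc c            xs       {zero}  ()
  eval-suc zeroC        xs       {suc k} eq = eq
  eval-suc succC        xs       {suc k} eq = eq
  eval-suc (projC i)    xs       {suc k} eq = eq
  eval-suc (compC f gs) xs       {suc k} eq with >>=-just⁻ (evalList k gs xs) eq
  ... | ys , gs⇓ , f⇓ = >>=-just⁺ (evalList-suc gs xs gs⇓) (eval-suc f ys f⇓)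
  eval-suc (precC f g)  []       {suc k} eq = eval-suc f [] eq
  eval-suc (precC f g)  (n ∷ ys) {suc k} eq = precLoop-suc f g n ys eq
  eval-suc (muC f)      xs       {suc k} eq = muLoop-suc f xs k 0 eq

  evalList-suc : ∀ gs xs {k a} → evalList k gs xs ≡ just a → evalList (suc k) gs xs ≡ just a
  evalList-suc []       xs eq = eq
  evalList-suc (g ∷ gs) xs {k} eq with >>=-just⁻ (eval k g xs) eq
  ... | y , g⇓ , rest with >>=-just⁻ (evalList k gs xs) rest
  ... | ys , gs⇓ , refl = >>=-just⁺ (eval-suc g xs g⇓) (>>=-just⁺ (evalList-suc gs xs gs⇓) refl)

  precLoop-suc : ∀ f g n ys {k a} → precLoop k f g n ys ≡ just a → precLoop (suc k) f g n ys ≡ just a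
  precLoop-suc f g zero    ys eq = eval-suc f ys eq
  precLoop-suc f g (suc m) ys {k} eq with >>=-just⁻ (precLoop k f g m ys) eq
  ... | r , m⇓ , g⇓ = >>=-just⁺ (precLoop-suc f g m ys m⇓) (eval-suc g (m ∷ r ∷ ys) g⇓)

  -- The search bound of muLoop is tied to the fuel, so it grows along with it.
  muLoop-suc : ∀ {k} f xs j i {a} → muLoop k f xs j i ≡ just a → muLoop (suc k) f xs (suc j) i ≡ just a
  muLoop-suc {k} f xs (suc j) i eq with eval k f (i ∷ xs) in f⇓
  ... | just zero    rewrite eval-suc f (i ∷ xs) {k} f⇓ = eq
  ... | just (suc _) rewrite eval-suc f (i ∷ xs) {k} f⇓ = muLoop-suc f xs j (suc i) eq

eval-mono : ∀ c xs → FuelMonotone (λ k → eval k c xs)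
eval-mono c xs = record { fuel-suc = eval-suc c xs }

evalList-mono : ∀ gs xs → FuelMonotone (λ k → evalList k gs xs)
evalList-mono gs xs = record { fuel-suc = evalList-suc gs xs }

precLoop-mono : ∀ f g n ys → FuelMonotone (λ k → precLoop k f g n ys)
precLoop-mono f g n ys = record { fuel-suc = precLoop-suc f g n ys }

⇓-deterministic : ∀ {e x y y′} → e · x ⇓ y → e · x ⇓ y′ → y ≡ y′
⇓-deterministic {e} {x} = converges-deterministic (eval-mono (decode e) (x ∷ []))

record Computes (c : Code) (F : List ℕ → ℕ) : Set where
  constructor computes
  field run : ∀ xs → Converges (λ k → eval k c xs) (F xs)
open Computes

record ComputesList (gs : List Code) (G : List ℕ → List ℕ) : Set where
  constructor computesList
  field runList : ∀ xs → Converges (λ k → evalList k gs xs) (G xs)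
open ComputesList

zeroC-computes : Computes zeroC (λ _ → 0)
zeroC-computes = computes λ _ → 1 , refl

succC-computes : Computes succC (λ xs → suc (arg 0 xs))
succC-computes = computes λ _ → 1 , refl

projC-computes : ∀ i → Computes (projC i) (arg i)
projC-computes i = computes λ _ → 1 , refl

[]-computes : ComputesList [] (λ _ → [])
[]-computes = computesList λ _ → 0 , refl

∷-computes : ∀ {g gs G Gs} → Computes g G → ComputesList gs Gs →
             ComputesList (g ∷ gs) (λ xs → G xs ∷ Gs xs)
∷-computes {g} {gs} (computes rg) (computesList rgs) = computesList λ xs →
  let k , g⇓ , gs⇓ = converge-together (eval-mono g xs) (evalList-mono gs xs) (rg xs) (rgs xs)
  in k , >>=-just⁺ g⇓ (>>=-just⁺ gs⇓ refl)

compC-computes : ∀ {f gs F G} → Computes f F → ComputesList gs G → Computes (compC f gs) (λ xs → F (G xs))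
compC-computes {f} {gs} {G = G} (computes rf) (computesList rgs) = computes λ xs →
  let k , gs⇓ , f⇓ = converge-together (evalList-mono gs xs) (eval-mono f (G xs)) (rgs xs) (rf (G xs))
  in suc k , >>=-just⁺ gs⇓ f⇓

precC-computes : ∀ {f g F G} → Computes f F → Computes g G → (h : ℕ → List ℕ → ℕ) →
                 (∀ ys → F ys ≡ h 0 ys) → (∀ m ys → G (m ∷ h m ys ∷ ys) ≡ h (suc m) ys) →
                 Computes (precC f g) (λ xs → h (arg 0 xs) (drop 1 xs))
precC-computes {f} {g} (computes rf) (computes rg) h base step = computes λ where
    []       → let k , eq = loop 0 [] in suc k , eq
    (n ∷ ys) → let k , eq = loop n ys in suc k , eq
  where
  loop : ∀ n ys → Converges (λ k → precLoop k f g n ys) (h n ys)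
  loop zero    ys = let k , eq = rf ys in k , trans eq (cong just (base ys))
  loop (suc m) ys =
    let k , m⇓ , g⇓ = converge-together (precLoop-mono f g m ys) (eval-mono g (m ∷ h m ys ∷ ys))
                                        (loop m ys) (rg (m ∷ h m ys ∷ ys))
    in k , >>=-just⁺ m⇓ (trans g⇓ (cong just (step m ys)))

compC₁-computes : ∀ {f g F G} → Computes f F → Computes g G →
                  Computes (compC f (g ∷ [])) (λ xs → F (G xs ∷ []))
compC₁-computes cf cg = compC-computes cf (∷-computes cg []-computes)

compC₂-computes : ∀ {f g h F G H} → Computes f F → Computes g G → Computes h H →
                  Computes (compC f (g ∷ h ∷ [])) (λ xs → F (G xs ∷ H xs ∷ []))
compC₂-computes cf cg ch = compC-computes cf (∷-computes cg (∷-computes ch []-computes))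

constC : ℕ → Code
constC zero    = zeroC
constC (suc n) = compC succC (constC n ∷ [])

constC-computes : ∀ n → Computes (constC n) (λ _ → n)
constC-computes zero    = zeroC-computes
constC-computes (suc n) = compC₁-computes succC-computes (constC-computes n)

isZero : ℕ → ℕ
isZero zero    = 1
isZero (suc _) = 0

isZeroC : Code
isZeroC = precC (constC 1) zeroC

isZeroC-computes : Computes isZeroC (λ xs → isZero (arg 0 xs))
isZeroC-computes =
  precC-computes (constC-computes 1) zeroC-computes (λ n _ → isZero n) (λ _ → refl) (λ _ _ → refl)

sign : ℕ → ℕ
sign zero    = 0
sign (suc _) = 1

signC : Code
signC = precC zeroC (constC 1)

signC-computes : Computes signC (λ xs → sign (arg 0 xs))
signC-computes =
  precC-computes zeroC-computes (constC-computes 1) (λ n _ → sign n) (λ _ → refl) (λ _ _ → refl)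

parity : ℕ → ℕ
parity zero    = 0
parity (suc m) = isZero (parity m)

parity-01 : ∀ n → parity n ≡ 0 ⊎ parity n ≡ 1
parity-01 zero = inj₁ refl
parity-01 (suc n) with parity-01 n
... | inj₁ eq rewrite eq = inj₂ refl
... | inj₂ eq rewrite eq = inj₁ refl

parity+isZero : ∀ n → parity n + isZero (parity n) ≡ 1
parity+isZero n with parity-01 n
... | inj₁ eq rewrite eq = refl
... | inj₂ eq rewrite eq = refl

parityC : Code
parityC = precC zeroC (compC isZeroC (projC 1 ∷ []))

parityC-computes : Computes parityC (λ xs → parity (arg 0 xs))
parityC-computes = precC-computes zeroC-computes (compC₁-computes isZeroC-computes (projC-computes 1))
                                  (λ n _ → parity n) (λ _ → refl) (λ _ _ → refl)

addC : Code
addC = precC (projC 0) (compC succC (projC 1 ∷ []))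

addC-computes : Computes addC (λ xs → arg 0 xs + arg 0 (drop 1 xs))
addC-computes = precC-computes (projC-computes 0) (compC₁-computes succC-computes (projC-computes 1))
                               (λ n ys → n + arg 0 ys) (λ _ → refl) (λ _ _ → refl)

times6C : Code
times6C = precC zeroC (compC addC (constC 6 ∷ projC 1 ∷ []))

times6C-computes : Computes times6C (λ xs → arg 0 xs * 6)
times6C-computes =
  precC-computes zeroC-computes (compC₂-computes addC-computes (constC-computes 6) (projC-computes 1))
                 (λ n _ → n * 6) (λ _ → refl) (λ _ _ → refl)

triangle : ℕ → ℕ
triangle zero    = 0
triangle (suc m) = triangle m + suc m

triangleC : Code
triangleC = precC zeroC (compC addC (projC 1 ∷ compC succC (projC 0 ∷ []) ∷ []))

triangleC-computes : Computes triangleC (λ xs → triangle (arg 0 xs))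
triangleC-computes =
  precC-computes zeroC-computes
                 (compC₂-computes addC-computes (projC-computes 1)
                                  (compC₁-computes succC-computes (projC-computes 0)))
                 (λ n _ → triangle n) (λ _ → refl) (λ _ _ → refl)

⌊suc/2⌋≡⌊/2⌋+parity : ∀ m → ⌊ suc m /2⌋ ≡ ⌊ m /2⌋ + parity m
⌊suc/2⌋≡⌊/2⌋+parity zero    = refl
⌊suc/2⌋≡⌊/2⌋+parity (suc m) = begin
  suc ⌊ m /2⌋                              ≡⟨ +-comm 1 ⌊ m /2⌋ ⟩
  ⌊ m /2⌋ + 1                              ≡⟨ cong (⌊ m /2⌋ +_) (parity+isZero m) ⟨
  ⌊ m /2⌋ + (parity m + isZero (parity m)) ≡⟨ +-assoc ⌊ m /2⌋ (parity m) _ ⟨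
  ⌊ m /2⌋ + parity m + isZero (parity m)   ≡⟨ cong (_+ isZero (parity m)) (⌊suc/2⌋≡⌊/2⌋+parity m) ⟨
  ⌊ suc m /2⌋ + isZero (parity m)          ∎
  where open ≡-Reasoning

halfC : Code
halfC = precC zeroC (compC addC (projC 1 ∷ compC parityC (projC 0 ∷ []) ∷ []))

halfC-computes : Computes halfC (λ xs → ⌊ arg 0 xs /2⌋)
halfC-computes =
  precC-computes zeroC-computes
                 (compC₂-computes addC-computes (projC-computes 1)
                                  (compC₁-computes parityC-computes (projC-computes 0)))
                 (λ n _ → ⌊ n /2⌋) (λ _ → refl) (λ m _ → sym (⌊suc/2⌋≡⌊/2⌋+parity m))

half^ : ℕ → ℕ → ℕ
half^ zero    c = c
half^ (suc m) c = ⌊ half^ m c /2⌋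

half^C : Code
half^C = precC (projC 0) (compC halfC (projC 1 ∷ []))

half^C-computes : Computes half^C (λ xs → half^ (arg 0 xs) (arg 0 (drop 1 xs)))
half^C-computes = precC-computes (projC-computes 0) (compC₁-computes halfC-computes (projC-computes 1))
                                 (λ n ys → half^ n (arg 0 ys)) (λ _ → refl) (λ _ _ → refl)

bit : ℕ → ℕ → ℕ
bit x c = parity (half^ x c)

bitC : Code
bitC = compC parityC (half^C ∷ [])

memberC : ℕ → Code
memberC c = compC bitC (projC 0 ∷ constC c ∷ [])

memberC-computes : ∀ c → Computes (memberC c) (λ xs → bit (arg 0 xs) c)
memberC-computes c = compC₂-computes (compC₁-computes parityC-computes half^C-computes)
                                     (projC-computes 0) (constC-computes c)

parity-+2 : ∀ n → parity (2 + n) ≡ parity n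
parity-+2 n with parity-01 n
... | inj₁ eq rewrite eq = refl
... | inj₂ eq rewrite eq = refl

parity-double+ : ∀ a s → parity (a + a + s) ≡ parity s
parity-double+ zero    s = refl
parity-double+ (suc a) s rewrite +-suc a a = trans (parity-+2 (a + a + s)) (parity-double+ a s)

⌊double+/2⌋ : ∀ a s → ⌊ a + a + s /2⌋ ≡ a + ⌊ s /2⌋
⌊double+/2⌋ zero    s = refl
⌊double+/2⌋ (suc a) s rewrite +-suc a a = cong suc (⌊double+/2⌋ a s)

n≡⌊n/2⌋+⌊n/2⌋+parity : ∀ n → n ≡ ⌊ n /2⌋ + ⌊ n /2⌋ + parity n
n≡⌊n/2⌋+⌊n/2⌋+parity zero          = refl
n≡⌊n/2⌋+⌊n/2⌋+parity (suc zero)    = refl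
n≡⌊n/2⌋+⌊n/2⌋+parity (suc (suc n)) rewrite parity-+2 n | +-suc ⌊ n /2⌋ ⌊ n /2⌋ =
  cong (2 +_) (n≡⌊n/2⌋+⌊n/2⌋+parity n)

half^-suc : ∀ x c → half^ (suc x) c ≡ half^ x ⌊ c /2⌋
half^-suc zero    c = refl
half^-suc (suc x) c = cong ⌊_/2⌋ (half^-suc x c)

bit-zero : ∀ x → bit x 0 ≡ 0
bit-zero x = cong parity (half^-zero x)
  where
  half^-zero : ∀ x → half^ x 0 ≡ 0
  half^-zero zero    = refl
  half^-zero (suc x) = cong ⌊_/2⌋ (half^-zero x)

bit-suc : ∀ x c → bit (suc x) c ≡ bit x ⌊ c /2⌋
bit-suc x c = cong parity (half^-suc x c)

bit-01 : ∀ x c → bit x c ≡ 0 ⊎ bit x c ≡ 1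
bit-01 x c = parity-01 (half^ x c)

bit≢1⇒bit≡0 : ∀ x c → bit x c ≢ 1 → bit x c ≡ 0
bit≢1⇒bit≡0 x c ≢1 with bit-01 x c
... | inj₁ ≡0 = ≡0
... | inj₂ ≡1 = contradiction ≡1 ≢1

bit≡1⇒< : ∀ x c → bit x c ≡ 1 → x < c
bit≡1⇒< zero    (suc c) _  = z<s
bit≡1⇒< (suc x) c       eq = begin-strict
  suc x                        ≤⟨ x<⌊c/2⌋ ⟩
  ⌊ c /2⌋                      <⟨ m<m+n _ (≤-trans z<s x<⌊c/2⌋) ⟩
  ⌊ c /2⌋ + ⌊ c /2⌋            ≤⟨ m≤m+n _ (parity c) ⟩
  ⌊ c /2⌋ + ⌊ c /2⌋ + parity c ≡⟨ n≡⌊n/2⌋+⌊n/2⌋+parity c ⟨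
  c                            ∎
  where
  open ≤-Reasoning
  x<⌊c/2⌋ : x < ⌊ c /2⌋
  x<⌊c/2⌋ = bit≡1⇒< x ⌊ c /2⌋ (trans (sym (bit-suc x c)) eq)

bit-injective : ∀ {a b} → (∀ x → bit x a ≡ bit x b) → a ≡ b
bit-injective {a} {b} = go (a + b) (m≤m+n a b) (m≤n+m b a)
  where
  ⌊/2⌋-≤-pred : ∀ {m N} → m ≤ suc N → ⌊ m /2⌋ ≤ N
  ⌊/2⌋-≤-pred {zero}  _  = z≤n
  ⌊/2⌋-≤-pred {suc m} le = s≤s⁻¹ (≤-trans (⌊n/2⌋<n m) le)
  go : ∀ N {a b} → a ≤ N → b ≤ N → (∀ x → bit x a ≡ bit x b) → a ≡ b
  go zero    z≤n z≤n _    = refl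
  go (suc N) {a} {b} a≤ b≤ same = begin
    a                                ≡⟨ n≡⌊n/2⌋+⌊n/2⌋+parity a ⟩
    ⌊ a /2⌋ + ⌊ a /2⌋ + parity a     ≡⟨ cong₂ (λ h p → h + h + p) halves-equal (same 0) ⟩
    ⌊ b /2⌋ + ⌊ b /2⌋ + parity b     ≡⟨ sym (n≡⌊n/2⌋+⌊n/2⌋+parity b) ⟩
    b                                ∎
    where
    open ≡-Reasoning
    halves-equal : ⌊ a /2⌋ ≡ ⌊ b /2⌋
    halves-equal = go N (⌊/2⌋-≤-pred a≤) (⌊/2⌋-≤-pred b≤) λ x →
      trans (sym (bit-suc x a)) (trans (same (suc x)) (bit-suc x b))

2^[1+y]+s≡2^y+2^y+s : ∀ y s → 2 ^ suc y + s ≡ 2 ^ y + 2 ^ y + s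
2^[1+y]+s≡2^y+2^y+s y s = cong (λ t → 2 ^ y + t + s) (+-identityʳ (2 ^ y))

bit-2^+ : ∀ y s → bit y s ≡ 0 → bit y (2 ^ y + s) ≡ 1
bit-2^+ zero    s eq rewrite eq = refl
bit-2^+ (suc y) s eq rewrite 2^[1+y]+s≡2^y+2^y+s y s = begin
  bit (suc y) (2 ^ y + 2 ^ y + s)  ≡⟨ bit-suc y _ ⟩
  bit y ⌊ 2 ^ y + 2 ^ y + s /2⌋    ≡⟨ cong (bit y) (⌊double+/2⌋ (2 ^ y) s) ⟩
  bit y (2 ^ y + ⌊ s /2⌋)          ≡⟨ bit-2^+ y ⌊ s /2⌋ (trans (sym (bit-suc y s)) eq) ⟩
  1                                ∎
  where open ≡-Reasoning

bit-2^+-≢ : ∀ y x s → bit y s ≡ 0 → x ≢ y → bit x (2 ^ y + s) ≡ bit x s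
bit-2^+-≢ zero    zero    s _  x≢y = contradiction refl x≢y
bit-2^+-≢ zero    (suc x) s eq _   = begin
  bit (suc x) (suc s)          ≡⟨ bit-suc x (suc s) ⟩
  bit x ⌊ suc s /2⌋            ≡⟨ cong (bit x) (⌊suc/2⌋≡⌊/2⌋+parity s) ⟩
  bit x (⌊ s /2⌋ + parity s)   ≡⟨ cong (λ p → bit x (⌊ s /2⌋ + p)) eq ⟩
  bit x (⌊ s /2⌋ + 0)          ≡⟨ cong (bit x) (+-identityʳ ⌊ s /2⌋) ⟩
  bit x ⌊ s /2⌋                ≡⟨ bit-suc x s ⟨
  bit (suc x) s                ∎
  where open ≡-Reasoning
bit-2^+-≢ (suc y) zero    s _  _   rewrite 2^[1+y]+s≡2^y+2^y+s y s = parity-double+ (2 ^ y) s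
bit-2^+-≢ (suc y) (suc x) s eq x≢y rewrite 2^[1+y]+s≡2^y+2^y+s y s = begin
  bit (suc x) (2 ^ y + 2 ^ y + s)  ≡⟨ bit-suc x _ ⟩
  bit x ⌊ 2 ^ y + 2 ^ y + s /2⌋    ≡⟨ cong (bit x) (⌊double+/2⌋ (2 ^ y) s) ⟩
  bit x (2 ^ y + ⌊ s /2⌋)          ≡⟨ bit-2^+-≢ y x ⌊ s /2⌋ (trans (sym (bit-suc y s)) eq)
                                                       (x≢y ∘ cong suc) ⟩
  bit x ⌊ s /2⌋                    ≡⟨ bit-suc x s ⟨
  bit (suc x) s                    ∎
  where open ≡-Reasoning

sum2^ : List ℕ → ℕ
sum2^ U = sum (map (2 ^_) U)

bit-sum2^ : ∀ {U} → Unique U → ∀ x → bit x (sum2^ U) ≡ 1 ⇔ x ∈ U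
bit-sum2^ {[]}    []             x = mk⇔ (λ eq → contradiction (trans (sym (bit-zero x)) eq) λ ()) λ ()
bit-sum2^ {y ∷ U} (y∉U ∷ unique) x = mk⇔ to from
  where
  bit-y : bit y (sum2^ U) ≡ 0
  bit-y = bit≢1⇒bit≡0 y (sum2^ U) λ eq → All.lookup y∉U (Equivalence.to (bit-sum2^ unique y) eq) refl
  to : bit x (sum2^ (y ∷ U)) ≡ 1 → x ∈ y ∷ U
  to eq with x ≟ y
  ... | yes x≡y = here x≡y
  ... | no  x≢y = there (Equivalence.to (bit-sum2^ unique x) (trans (sym (bit-2^+-≢ y x _ bit-y x≢y)) eq))
  from : x ∈ y ∷ U → bit x (sum2^ (y ∷ U)) ≡ 1
  from (here refl) = bit-2^+ x _ bit-y
  from (there x∈U) = trans (bit-2^+-≢ y x _ bit-y λ { refl → All.lookup y∉U x∈U refl })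
                           (Equivalence.from (bit-sum2^ unique x) x∈U)

bit-≡ : ∀ x a b → (bit x a ≡ 1 → bit x b ≡ 1) → (bit x b ≡ 1 → bit x a ≡ 1) →
        bit x a ≡ bit x b
bit-≡ x a b a⇒b b⇒a with bit-01 x a | bit-01 x b
... | inj₁ a≡0 | inj₁ b≡0 = trans a≡0 (sym b≡0)
... | inj₁ a≡0 | inj₂ b≡1 = contradiction (trans (sym a≡0) (b⇒a b≡1)) λ ()
... | inj₂ a≡1 | inj₁ b≡0 = contradiction (trans (sym b≡0) (a⇒b a≡1)) λ ()
... | inj₂ a≡1 | inj₂ b≡1 = trans a≡1 (sym b≡1)

-- Gödel numbers of codes

opaque
  pairing : ℕ → ℕ → ℕ
  pairing a b = triangle (a + b) + a

  pairing-sucˡ : ∀ a b → pairing (suc a) b ≡ suc (pairing a (suc b))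
  pairing-sucˡ a b rewrite +-suc a b = +-suc (triangle (suc (a + b))) a

  pairing-0-suc : ∀ b → pairing 0 (suc b) ≡ suc (pairing b 0)
  pairing-0-suc b rewrite +-identityʳ b | +-identityʳ (triangle b + suc b) = +-suc (triangle b) b

  pairing-0-0 : pairing 0 0 ≡ 0
  pairing-0-0 = refl

  ≤-pairingˡ : ∀ a b → a ≤ pairing a b
  ≤-pairingˡ a b = m≤n+m a _

  ≤-pairingʳ : ∀ a b → b ≤ pairing a b
  ≤-pairingʳ a b = ≤-trans (m≤n+m b a) (≤-trans (≤-triangle (a + b)) (m≤m+n _ a))
    where
    ≤-triangle : ∀ n → n ≤ triangle n
    ≤-triangle zero    = z≤n
    ≤-triangle (suc n) = m≤n+m (suc n) (triangle n)

  pairingC : Code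
  pairingC = compC addC (compC triangleC (addC ∷ []) ∷ projC 0 ∷ [])

  pairingC-computes : Computes pairingC (λ xs → pairing (arg 0 xs) (arg 0 (drop 1 xs)))
  pairingC-computes =
    compC₂-computes addC-computes (compC₁-computes triangleC-computes addC-computes) (projC-computes 0)

unpair-pairing : ∀ a b → unpair (pairing a b) ≡ (a , b)
unpair-pairing a b = go _ a b refl
  where
  go : ∀ n a b → pairing a b ≡ n → unpair n ≡ (a , b)
  go zero    zero    zero    _  = refl
  go zero    (suc a) b       eq with () ← trans (sym (pairing-sucˡ a b)) eq
  go zero    zero    (suc b) eq with () ← trans (sym (pairing-0-suc b)) eq
  go (suc n) zero    zero    eq with () ← trans (sym pairing-0-0) eq
  go (suc n) (suc a) b       eq
    rewrite go n a (suc b) (suc-injective (trans (sym (pairing-sucˡ a b)) eq)) = refl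
  go (suc n) zero    (suc b) eq
    rewrite go n b zero (suc-injective (trans (sym (pairing-0-suc b)) eq)) = refl

tagC : ℕ → Code → Code
tagC t X = compC addC (constC t ∷ compC times6C (X ∷ []) ∷ [])

tagC-computes : ∀ t {X F} → Computes X F → Computes (tagC t X) (λ xs → t + F xs * 6)
tagC-computes t cX = compC₂-computes addC-computes (constC-computes t) (compC₁-computes times6C-computes cX)

mutual
  encode : Code → ℕ
  encode zeroC        = 0
  encode succC        = 1
  encode (projC i)    = 2 + i * 6
  encode (compC f gs) = 3 + pairing (encode f) (encodeList gs) * 6
  encode (precC f g)  = 4 + pairing (encode f) (encode g) * 6
  encode (muC f)      = 5 + encode f * 6

  encodeList : List Code → ℕ
  encodeList []       = 0
  encodeList (g ∷ gs) = suc (pairing (encode g) (encodeList gs))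

module _ (t : ℕ) {t<6 : True (t <? 6)} (r : ℕ) where

  [t+r*6]%6≡t : (t + r * 6) % 6 ≡ t
  [t+r*6]%6≡t = trans ([m+kn]%n≡m%n t r 6) (m<n⇒m%n≡m (toWitness t<6))

  [t+r*6]/6≡r : (t + r * 6) / 6 ≡ r
  [t+r*6]/6≡r = trans (+-distrib-/-∣ʳ t (divides-refl r))
                      (cong₂ _+_ (m<n⇒m/n≡0 (toWitness t<6)) (m*n/n≡m r 6))

t+r*6≤1+f⇒r≤f : ∀ t r {f} → t + r * 6 ≤ suc f → r ≤ f
t+r*6≤1+f⇒r≤f t zero    _  = z≤n
t+r*6≤1+f⇒r≤f t (suc r) le =
  ≤-trans (s≤s (≤-trans (m≤m*n r 6) (m≤n+m (r * 6) 4))) (s≤s⁻¹ (≤-trans (m≤n+m (suc r * 6) t) le))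

mutual
  decodeF-encode : ∀ f c → encode c ≤ f → decodeF f (encode c) ≡ c
  decodeF-encode zero    zeroC        _ = refl
  decodeF-encode (suc f) zeroC        _ = refl
  decodeF-encode (suc f) succC        _ = refl
  decodeF-encode (suc f) (projC i)    _
    rewrite [t+r*6]%6≡t 2 i | [t+r*6]/6≡r 2 i = refl
  decodeF-encode (suc f) (compC g gs) le
    rewrite [t+r*6]%6≡t 3 (pairing (encode g) (encodeList gs))
          | [t+r*6]/6≡r 3 (pairing (encode g) (encodeList gs))
          | unpair-pairing (encode g) (encodeList gs)
    = cong₂ compC (decodeF-encode f g (≤-trans (≤-pairingˡ _ _) r≤f))
                  (decodeListF-encode f gs (≤-trans (≤-pairingʳ _ _) r≤f))
    where r≤f = t+r*6≤1+f⇒r≤f 3 (pairing (encode g) (encodeList gs)) le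
  decodeF-encode (suc f) (precC g h)  le
    rewrite [t+r*6]%6≡t 4 (pairing (encode g) (encode h))
          | [t+r*6]/6≡r 4 (pairing (encode g) (encode h))
          | unpair-pairing (encode g) (encode h)
    = cong₂ precC (decodeF-encode f g (≤-trans (≤-pairingˡ _ _) r≤f))
                  (decodeF-encode f h (≤-trans (≤-pairingʳ _ _) r≤f))
    where r≤f = t+r*6≤1+f⇒r≤f 4 (pairing (encode g) (encode h)) le
  decodeF-encode (suc f) (muC g)      le
    rewrite [t+r*6]%6≡t 5 (encode g) | [t+r*6]/6≡r 5 (encode g)
    = cong muC (decodeF-encode f g (t+r*6≤1+f⇒r≤f 5 (encode g) le))

  decodeListF-encode : ∀ f gs → encodeList gs ≤ f → decodeListF f (encodeList gs) ≡ gs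
  decodeListF-encode zero    []       _ = refl
  decodeListF-encode (suc f) []       _ = refl
  decodeListF-encode (suc f) (g ∷ gs) le rewrite unpair-pairing (encode g) (encodeList gs)
    = cong₂ _∷_ (decodeF-encode f g (≤-trans (≤-pairingˡ _ _) (s≤s⁻¹ le)))
                (decodeListF-encode f gs (≤-trans (≤-pairingʳ _ _) (s≤s⁻¹ le)))

decode-encode : ∀ c → decode (encode c) ≡ c
decode-encode c = decodeF-encode (encode c) c ≤-refl

encode-⇓ : ∀ {c F} → Computes c F → ∀ x → encode c · x ⇓ F (x ∷ [])
encode-⇓ {c} cF x rewrite decode-encode c = run cF (x ∷ [])

≐-refl : ∀ {A : SetN} → A ≐ A
≐-refl x = id , id

≐-sym : ∀ {A B : SetN} → A ≐ B → B ≐ A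
≐-sym A≐B x = swap (A≐B x)

≐-trans : ∀ {A B D : SetN} → A ≐ B → B ≐ D → A ≐ D
≐-trans A≐B B≐D x = proj₁ (B≐D x) ∘ proj₁ (A≐B x) , proj₂ (A≐B x) ∘ proj₂ (B≐D x)

⇓-CIndex : ∀ {f : ℕ → ℕ} e → (∀ x → e · x ⇓ f x) → (∀ x → f x ≡ 0 ⊎ f x ≡ 1) → CIndex e
⇓-CIndex {f} e ⇓f f01 x = Sum.map ⇓-≡ ⇓-≡ (f01 x)
  where
  ⇓-≡ : ∀ {y} → f x ≡ y → e · x ⇓ y
  ⇓-≡ eq = subst (e · x ⇓_) eq (⇓f x)

⇓-C : ∀ {f : ℕ → ℕ} e → (∀ x → e · x ⇓ f x) → C e ≐ (λ x → f x ≡ 1)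
⇓-C e ⇓f x = (λ ⇓1 → ⇓-deterministic {e} (⇓f x) ⇓1) , (λ eq → subst (e · x ⇓_) eq (⇓f x))

encodeConstC : Code
encodeConstC =
  precC zeroC (tagC 3 (compC pairingC (constC (encode succC) ∷
                                       compC succC (compC pairingC (projC 1 ∷ zeroC ∷ []) ∷ []) ∷ [])))

encodeConstC-computes : Computes encodeConstC (λ xs → encode (constC (arg 0 xs)))
encodeConstC-computes =
  precC-computes zeroC-computes
                 (tagC-computes 3 (compC₂-computes pairingC-computes (constC-computes (encode succC))
                   (compC₁-computes succC-computes
                     (compC₂-computes pairingC-computes (projC-computes 1) zeroC-computes))))
                 (λ n _ → encode (constC n)) (λ _ → refl) (λ _ _ → refl)

-- Follows the clauses of encode on memberC c; only the Gödel number of constC c depends on c.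
encodeMemberC : Code
encodeMemberC =
  tagC 3 (compC pairingC (constC (encode bitC) ∷
          compC succC (compC pairingC (constC (encode (projC 0)) ∷
                       compC succC (compC pairingC (encodeConstC ∷ zeroC ∷ []) ∷ []) ∷ []) ∷ []) ∷ []))

encodeMemberC-computes : Computes encodeMemberC (λ xs → encode (memberC (arg 0 xs)))
encodeMemberC-computes =
  tagC-computes 3 (compC₂-computes pairingC-computes (constC-computes (encode bitC))
    (compC₁-computes succC-computes (compC₂-computes pairingC-computes (constC-computes (encode (projC 0)))
      (compC₁-computes succC-computes (compC₂-computes pairingC-computes encodeConstC-computes zeroC-computes)))))

conjecture : ℕ → ℕ → ℕ
conjecture zero    c = encode signC
conjecture (suc _) c = encode (memberC c)

conjectureC : Code
conjectureC = precC (constC (encode signC)) (compC encodeMemberC (projC 2 ∷ []))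

conjectureC-computes : Computes conjectureC (λ xs → conjecture (arg 0 xs) (arg 0 (drop 1 xs)))
conjectureC-computes =
  precC-computes (constC-computes (encode signC)) (compC₁-computes encodeMemberC-computes (projC-computes 2))
                 (λ n ys → conjecture n (arg 0 ys)) (λ _ → refl) (λ _ _ → refl)

learnerC : Code
learnerC = compC conjectureC (compC parityC (projC 0 ∷ []) ∷ projC 0 ∷ [])

learnerC-computes : Computes learnerC (λ xs → conjecture (parity (arg 0 xs)) (arg 0 xs))
learnerC-computes =
  compC₂-computes conjectureC-computes (compC₁-computes parityC-computes (projC-computes 0)) (projC-computes 0)

Positive : SetN
Positive x = ∃[ y ] x ≡ suc y

FinSet : ℕ → SetN
FinSet c x = bit x c ≡ 1

signC-CIndex : CIndex (encode signC)
signC-CIndex = ⇓-CIndex (encode signC) (encode-⇓ signC-computes) λ where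
  zero    → inj₁ refl
  (suc _) → inj₂ refl

signC-C : C (encode signC) ≐ Positive
signC-C = ≐-trans (⇓-C (encode signC) (encode-⇓ signC-computes)) λ where
  zero    → (λ ()) , λ ()
  (suc x) → (λ _ → x , refl) , (λ _ → refl)

memberC-CIndex : ∀ c → CIndex (encode (memberC c))
memberC-CIndex c = ⇓-CIndex (encode (memberC c)) (encode-⇓ (memberC-computes c)) λ x → bit-01 x c

memberC-C : ∀ c → C (encode (memberC c)) ≐ FinSet c
memberC-C c = ⇓-C (encode (memberC c)) (encode-⇓ (memberC-computes c))

conjecture-CIndex : ∀ p c → CIndex (conjecture p c)
conjecture-CIndex zero    c = signC-CIndex
conjecture-CIndex (suc _) c = memberC-CIndex c

learner : ℕ
learner = encode learnerC

learner-⇓ : ∀ c → learner · c ⇓ conjecture (parity c) c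
learner-⇓ = encode-⇓ learnerC-computes

∈-catMaybes⁻ : ∀ {A : Set} {x : A} (ms : List (Maybe A)) → x ∈ catMaybes ms → just x ∈ ms
∈-catMaybes⁻ (nothing ∷ ms) x∈          = there (∈-catMaybes⁻ ms x∈)
∈-catMaybes⁻ (just y ∷ ms)  (here refl) = here refl
∈-catMaybes⁻ (just y ∷ ms)  (there x∈)  = there (∈-catMaybes⁻ ms x∈)

∈-catMaybes⁺ : ∀ {A : Set} {x : A} (ms : List (Maybe A)) → just x ∈ ms → x ∈ catMaybes ms
∈-catMaybes⁺ (just y ∷ ms)  (here refl) = here refl
∈-catMaybes⁺ (nothing ∷ ms) (there x∈)  = ∈-catMaybes⁺ ms x∈
∈-catMaybes⁺ (just y ∷ ms)  (there x∈)  = there (∈-catMaybes⁺ ms x∈)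

InPrefix : Text → ℕ → ℕ → Set
InPrefix T i x = ∃[ n ] n < i × T n ≡ just x

bit-contentCode⁻ : ∀ T i x → bit x (contentCode T i) ≡ 1 → InPrefix T i x
bit-contentCode⁻ T i x eq =
  let x∈ = Equivalence.from (deduplicate-∈⇔ _≟_) (Equivalence.to (bit-sum2^ (deduplicate-! _≟_ _) x) eq)
      n , n∈ , x≡Tn = ∈-map⁻ T (∈-catMaybes⁻ (map T (upTo i)) x∈)
  in n , ∈-upTo⁻ n∈ , sym x≡Tn

bit-contentCode⁺ : ∀ T i x → InPrefix T i x → bit x (contentCode T i) ≡ 1
bit-contentCode⁺ T i x (n , n<i , Tn≡x) =
  Equivalence.from (bit-sum2^ (deduplicate-! _≟_ _) x)
    (Equivalence.to (deduplicate-∈⇔ _≟_)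
      (∈-catMaybes⁺ (map T (upTo i)) (subst (_∈ map T (upTo i)) Tn≡x (∈-map⁺ T (∈-upTo⁺ n<i)))))

InPrefix-mono : ∀ {T i j x} → i ≤ j → InPrefix T i x → InPrefix T j x
InPrefix-mono i≤j (n , n<i , Tn≡x) = n , <-≤-trans n<i i≤j , Tn≡x

InPrefix⇒content : ∀ {T i x} → InPrefix T i x → content T x
InPrefix⇒content (n , _ , Tn≡x) = n , Tn≡x

prefix-covers : ∀ {T} {P : SetN} → Decidable P → (∀ x → P x → content T x) →
                ∀ N → ∃[ i ] ∀ x → x < N → P x → InPrefix T i x
prefix-covers P? P⊆T zero = 0 , λ _ ()
prefix-covers P? P⊆T (suc N) with prefix-covers P? P⊆T N | P? N
... | i , covers | no ¬PN = i , λ x x<1+N Px → case m≤n⇒m<n∨m≡n (s≤s⁻¹ x<1+N) of λ where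
  (inj₁ x<N)  → covers x x<N Px
  (inj₂ refl) → contradiction Px ¬PN
... | i , covers | yes PN = let n , Tn≡N = P⊆T N PN in i ⊔ suc n , λ x x<1+N Px →
  case m≤n⇒m<n∨m≡n (s≤s⁻¹ x<1+N) of λ where
    (inj₁ x<N)  → InPrefix-mono (m≤m⊔n i (suc n)) (covers x x<N Px)
    (inj₂ refl) → n , <-≤-trans (n<1+n n) (m≤n⊔m i (suc n)) , Tn≡N

contentCode-stabilises : ∀ T c → content T ≐ FinSet c →
                         ∃[ i₀ ] ∀ n → i₀ ≤ n → contentCode T n ≡ c
contentCode-stabilises T c T≐D =
  let i₀ , covers = prefix-covers (λ x → bit x c ≟ 1) (λ x → proj₂ (T≐D x)) c
  in i₀ , λ n i₀≤n → bit-injective λ x → bit-≡ x (contentCode T n) c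
       (λ in-n → proj₁ (T≐D x) (InPrefix⇒content (bit-contentCode⁻ T n x in-n)))
       (λ in-c → bit-contentCode⁺ T n x (InPrefix-mono i₀≤n (covers x (bit≡1⇒< x c in-c) in-c)))

content-≐-FinSet : ∀ T i → (∀ x → content T x → InPrefix T i x) → content T ≐ FinSet (contentCode T i)
content-≐-FinSet T i T⊆prefix x =
  bit-contentCode⁺ T i x ∘ T⊆prefix x , InPrefix⇒content ∘ bit-contentCode⁻ T i x

-- The class is learnable set-driven with C-indices

𝓛 : SetN → Set
𝓛 L = (L ≐ Positive) ⊎ (∃[ c ] FinSet c 0 × (L ≐ FinSet c))

𝓛⊆REC : ∀ L → 𝓛 L → REC L
𝓛⊆REC L (inj₁ L≐Pos)         = encode signC , signC-CIndex , ≐-trans signC-C (≐-sym L≐Pos)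
𝓛⊆REC L (inj₂ (c , _ , L≐D)) =
  encode (memberC c) , memberC-CIndex c , ≐-trans (memberC-C c) (≐-sym L≐D)

Sd-learner-total : ∀ T → Total (Sd learner T)
Sd-learner-total T i = let c = contentCode T i in conjecture (parity c) c , learner-⇓ c

learner-CInd : ∀ T → CInd (Sd learner T) T
learner-CInd T i =
  let c = contentCode T i in conjecture (parity c) c , learner-⇓ c , conjecture-CIndex (parity c) c

learner-Positive : ∀ T → content T ≐ Positive → ExC (Sd learner T) T
learner-Positive T T≐Pos =
  Sd-learner-total T , 0 , encode signC , converged , signC-CIndex , ≐-trans signC-C (≐-sym T≐Pos)
  where
  converged : ∀ n → 0 ≤ n → Sd learner T n (encode signC)
  converged n _ = subst (λ p → learner · contentCode T n ⇓ conjecture p (contentCode T n))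
                        (bit≢1⇒bit≡0 0 (contentCode T n) 0∉prefix) (learner-⇓ (contentCode T n))
    where
    0∉prefix : FinSet (contentCode T n) 0 → ⊥
    0∉prefix in-n with () ← proj₂ (proj₁ (T≐Pos 0) (InPrefix⇒content (bit-contentCode⁻ T n 0 in-n)))

learner-FinSet : ∀ T c → FinSet c 0 → content T ≐ FinSet c → ExC (Sd learner T) T
learner-FinSet T c 0∈D T≐D =
  let i₀ , stable = contentCode-stabilises T c T≐D
  in Sd-learner-total T , i₀ , encode (memberC c) , converged stable ,
     memberC-CIndex c , ≐-trans (memberC-C c) (≐-sym T≐D)
  where
  converged : ∀ {i₀} → (∀ n → i₀ ≤ n → contentCode T n ≡ c) →
              ∀ n → i₀ ≤ n → Sd learner T n (encode (memberC c))
  converged stable n i₀≤n rewrite stable n i₀≤n =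
    subst (λ p → learner · c ⇓ conjecture p c) 0∈D (learner-⇓ c)

learner-ExC : ∀ L → 𝓛 L → ∀ T → TextFor T L → ExC (Sd learner T) T
learner-ExC L (inj₁ L≐Pos)           T T≐L = learner-Positive T (≐-trans T≐L L≐Pos)
learner-ExC L (inj₂ (c , 0∈D , L≐D)) T T≐L = learner-FinSet T c 0∈D (≐-trans T≐L L≐D)

-- No iterative learner identifies the class

It-deterministic : ∀ h T k {e e′} → It h T k e → It h T k e′ → e ≡ e′
It-deterministic h T zero    ⇓e ⇓e′ = ⇓-deterministic {h} ⇓e ⇓e′
It-deterministic h T (suc k) (q , ⇓q , ⇓e) (q′ , ⇓q′ , ⇓e′) with It-deterministic h T k ⇓q ⇓q′
... | refl = ⇓-deterministic {h} ⇓e ⇓e′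

It-agree : ∀ h {T T′} k → (∀ n → n < k → T n ≡ T′ n) → ∀ {e} → It h T k e → It h T′ k e
It-agree h zero    _    ⇓e = ⇓e
It-agree h (suc k) T≡T′ {e} (q , ⇓q , ⇓e) =
  q , It-agree h k (λ n n<k → T≡T′ n (m<n⇒m<1+n n<k)) ⇓q ,
  subst (λ d → h · suc (pair q (codeD d)) ⇓ e) (T≡T′ k ≤-refl) ⇓e

It-shift : ∀ h {T T′} i j → (∀ n → T (i + n) ≡ T′ (j + n)) →
           (∀ {e} → It h T i e → It h T′ j e) → ∀ n {e} → It h T (i + n) e → It h T′ (j + n) e
It-shift h i j tails start zero    rewrite +-identityʳ i | +-identityʳ j = start
It-shift h i j tails start (suc n) {e} rewrite +-suc i n | +-suc j n = λ where
  (q , ⇓q , ⇓e) → q , It-shift h i j tails start n ⇓q ,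
                  subst (λ d → h · suc (pair q (codeD d)) ⇓ e) (tails n) ⇓e

It-synchronised⇒content-≐ : ∀ h {A B} i j → ExW (It h A) A → ExW (It h B) B →
                            (∀ n → A (i + n) ≡ B (j + n)) → (∀ {e} → It h A i e → It h B j e) →
                            content A ≐ content B
It-synchronised⇒content-≐ h {A} {B} i j (_ , n₁ , e₁ , conv₁ , W₁≐A) (_ , n₂ , e₂ , conv₂ , W₂≐B)
                          tails start =
  ≐-trans (≐-sym W₁≐A) (subst (λ e → W e ≐ content B) (sym e₁≡e₂) W₂≐B)
  where
  N = n₁ + n₂
  e₁≡e₂ : e₁ ≡ e₂
  e₁≡e₂ = It-deterministic h B (j + N)
            (It-shift h i j tails start N (conv₁ (i + N) (≤-trans (m≤m+n n₁ n₂) (m≤n+m N i))))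
            (conv₂ (j + N) (≤-trans (m≤n+m n₂ n₁) (m≤n+m N j)))

Tpos : Text
Tpos n = just (suc n)

Tpos-Positive : content Tpos ≐ Positive
Tpos-Positive x = (λ { (n , refl) → n , refl }) , (λ { (n , refl) → n , refl })

Tpos↾ : ℕ → Text
Tpos↾ m n with n <? m
... | yes _ = just (suc n)
... | no  _ = just 0

Tpos↾-< : ∀ {m n} → n < m → Tpos↾ m n ≡ just (suc n)
Tpos↾-< {m} {n} n<m with n <? m
... | yes _   = refl
... | no  n≮m = contradiction n<m n≮m

Tpos↾-≥ : ∀ {m n} → m ≤ n → Tpos↾ m n ≡ just 0
Tpos↾-≥ {m} {n} m≤n with n <? m
... | yes n<m = contradiction m≤n (<⇒≱ n<m)
... | no  _   = refl

Tpos↾-𝓛 : ∀ m → 𝓛 (content (Tpos↾ m))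
Tpos↾-𝓛 m = inj₂ (contentCode (Tpos↾ m) (suc m) ,
                  bit-contentCode⁺ (Tpos↾ m) (suc m) 0 (m , ≤-refl , Tpos↾-≥ ≤-refl) ,
                  content-≐-FinSet (Tpos↾ m) (suc m) in-prefix)
  where
  in-prefix : ∀ x → content (Tpos↾ m) x → InPrefix (Tpos↾ m) (suc m) x
  in-prefix x (n , Tn≡x) = case n <? m of λ where
    (yes n<m) → n , m<n⇒m<1+n n<m , Tn≡x
    (no  n≮m) → m , ≤-refl , trans (Tpos↾-≥ ≤-refl) (trans (sym (Tpos↾-≥ (≮⇒≥ n≮m))) Tn≡x)

Tpos↾-∌ : ∀ m → ¬ content (Tpos↾ m) (suc m)
Tpos↾-∌ m (n , Tn≡1+m) = case n <? m of λ where
  (yes n<m) → <-irrefl (suc-injective (just-injective (trans (sym (Tpos↾-< n<m)) Tn≡1+m))) n<m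
  (no  n≮m) → case trans (sym (Tpos↾-≥ (≮⇒≥ n≮m))) Tn≡1+m of λ ()

not-It-ExW : ∀ h → ¬ (∀ L → 𝓛 L → Learns NoRestr It ExW h L)
not-It-ExW h learns
  with proj₂ (learns Positive (inj₁ ≐-refl)) Tpos Tpos-Positive
... | _ , m , e₀ , conv₀ , _ = Tpos↾-∌ m (proj₂ (A≐B (suc m)) (m , Tpos↾-< ≤-refl))
  where
  A = Tpos↾ m
  B = Tpos↾ (suc m)
  learns-Tpos↾ : ∀ k → ExW (It h (Tpos↾ k)) (Tpos↾ k)
  learns-Tpos↾ k = proj₂ (learns _ (Tpos↾-𝓛 k)) (Tpos↾ k) ≐-refl
  start : ∀ {e} → It h A m e → It h B (suc m) e
  start ⇓e with It-deterministic h Tpos m (It-agree h m (λ _ n<m → Tpos↾-< n<m) ⇓e) (conv₀ m ≤-refl)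
  ... | refl = It-agree h (suc m) (λ _ n<1+m → sym (Tpos↾-< n<1+m)) (conv₀ (suc m) (n≤1+n m))
  A≐B : content A ≐ content B
  A≐B = It-synchronised⇒content-≐ h m (suc m) (learns-Tpos↾ m) (learns-Tpos↾ (suc m))
          (λ n → trans (Tpos↾-≥ (m≤m+n m n)) (sym (Tpos↾-≥ (m≤m+n (suc m) n)))) start

theorem12 : Σ[ 𝓛 ∈ (SetN → Set) ] (InClassREC CInd Sd ExC 𝓛 × ¬ InClassREC NoRestr It ExW 𝓛)
theorem12 =
  𝓛 , (𝓛⊆REC , learner , λ L L∈𝓛 → learner-CInd , learner-ExC L L∈𝓛) ,
  λ (_ , h , learns) → not-It-ExW h learns
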